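{- Let $n>k\ge 0$ be integers and let $\mu$ be a partition of $n-k$. Let $\mu 1^k$ denote the partition of $n$ obtained from $\mu$ by adding $k$ parts equal to $1$. Then \[ F_{\mu 1^k}(z)=(n-1)(n-2)\cdots(n-k)\,F_{\mu}(z). \]
   Context: For a positive integer $m$, $\mathfrak{S}_m$ is the symmetric group on $\{1,\dots,m\}$, $Q_m\subseteq\mathfrak{S}_m$ is the set of $m$-cycles, and $c(\eta)$ denotes the number of cycles (including fixed points) of a permutation $\eta$. Permutations are multiplied from left to right. For $\pi\in\mathfrak{S}_m$ the IO-polynomial is \[ F_\pi(z)=\sum_{\zeta\in Q_m} z^{\lfloor (c(\zeta\pi)-1)/2\rfloor}. \] A permutation has type $\lambda$ (a partition of $m$) if the multiset of its cycle lengths is $\lambda$. The polynomial $F_\pi(z)$ depends only on the type of $\pi$, so one writes $F_\lambda(z)=F_\pi(z)$ for any $\pi$ of type $\lambda$. -}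

module Defs where

open import Data.Nat as ℕ using (ℕ; zero; suc; _∸_; _/_)
open import Data.Fin as Fin using (Fin; toℕ)
open import Data.Fin.Properties using (all?; any?; _≟_)
open import Data.Vec as Vec using (Vec; []; _∷_)
open import Data.List using (List; []; _∷_; allFin; map; concatMap; filter; length; replicate; _++_)
open import Data.List.Relation.Unary.All using (All)
open import Data.Nat.ListAction using (sum)
import Agda.Primitive
open import Data.List.Relation.Binary.Permutation.Propositional using (_↭_)
open import Data.Fin.Permutation using (Permutation′; _⟨$⟩ʳ_)
open import Data.Product using (∃; _,_)
open import Relation.Nullary using (Dec; ¬_)
open import Relation.Nullary.Decidable using (_×-dec_)
open import Relation.Unary using (Pred; Decidable)
open import Relation.Binary.PropositionalEquality using (_≡_)

iter : ∀ {m} → (Fin m → Fin m) → ℕ → Fin m → Fin m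
iter f zero    x = x
iter f (suc t) x = iter f t (f x)

count : ∀ {m} {P : Pred (Fin m) Agda.Primitive.lzero} → Decidable P → ℕ
count P? = length (filter P? (allFin _))

InOrbit : ∀ {m} → (Fin m → Fin m) → Fin m → Fin m → Set
InOrbit {m} f i j = ∃ λ (t : Fin m) → iter f (toℕ t) i ≡ j

inOrbit? : ∀ {m} (f : Fin m → Fin m) (i : Fin m) → Decidable (InOrbit f i)
inOrbit? f i j = any? (λ t → iter f (toℕ t) i ≟ j)

-- i is the smallest element of its cycle (one representative per cycle)
IsRep : ∀ {m} → (Fin m → Fin m) → Fin m → Set
IsRep {m} f i = ∀ (t : Fin m) → i Fin.≤ iter f (toℕ t) i

isRep? : ∀ {m} (f : Fin m → Fin m) → Decidable (IsRep f)
isRep? f i = all? (λ (t : Fin _) → i Fin.≤? iter f (toℕ t) i)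

cycles : ∀ {m} → (Fin m → Fin m) → ℕ
cycles f = count (isRep? f)

cycleLength : ∀ {m} → (Fin m → Fin m) → Fin m → ℕ
cycleLength f i = count (inOrbit? f i)

cycleType : ∀ {m} → (Fin m → Fin m) → List ℕ
cycleType {m} f = map (cycleLength f) (filter (isRep? f) (allFin m))

HasType : ∀ {m} → Permutation′ m → List ℕ → Set
HasType π λ′ = cycleType (π ⟨$⟩ʳ_) ↭ λ′

IsPartition : ℕ → List ℕ → Set
IsPartition n λ′ = All (λ p → 1 ℕ.≤ p) λ′ × sum λ′ ≡ n
  where open import Data.Product using (_×_)

-- all endofunctions of Fin m, enumerated via all vectors (each exactly once)
allVecs : (m k : ℕ) → List (Vec (Fin m) k)
allVecs m zero    = [] ∷ []
allVecs m (suc k) = concatMap (λ v → map (_∷ v) (allFin m)) (allVecs m k)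

allFuns : (m : ℕ) → List (Fin m → Fin m)
allFuns m = map Vec.lookup (allVecs m m)

IsInjective : ∀ {m} → (Fin m → Fin m) → Set
IsInjective f = ∀ i j → f i ≡ f j → i ≡ j

isInjective? : ∀ {m} (f : Fin m → Fin m) → Dec (IsInjective f)
isInjective? f = all? λ i → all? λ j → dec i j
  where
  open import Relation.Nullary.Decidable using (_→-dec_)
  dec : ∀ i j → Dec (f i ≡ f j → i ≡ j)
  dec i j = (f i ≟ f j) →-dec (i ≟ j)

IsMCycle : ∀ {m} → (Fin m → Fin m) → Set
IsMCycle f = IsInjective f × (cycles f ≡ 1)
  where open import Data.Product using (_×_)

isMCycle? : ∀ {m} (f : Fin m → Fin m) → Dec (IsMCycle f)
isMCycle? f = isInjective? f ×-dec (cycles f ℕ.≟ 1)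

Q : (m : ℕ) → List (Fin m → Fin m)
Q m = filter isMCycle? (allFuns m)

-- product ζπ, multiplied left to right: first ζ, then π
_·_ : ∀ {m} → (Fin m → Fin m) → Permutation′ m → Fin m → Fin m
(ζ · π) i = π ⟨$⟩ʳ ζ i

expo : ∀ {m} → Permutation′ m → (Fin m → Fin m) → ℕ
expo π ζ = (cycles (ζ · π) ∸ 1) / 2

-- j-th coefficient of the IO-polynomial F_π(z) = Σ_{ζ ∈ Q_m} z^{⌊(c(ζπ)−1)/2⌋}
F : ∀ {m} → Permutation′ m → ℕ → ℕ
F {m} π j = length (filter (λ ζ → expo π ζ ℕ.≟ j) (Q m))

-- The proof combines two facts.
-- (1) F_π depends only on the cycle type of π.  If p and q have the same cycle type,
--     matching each cycle of p with a cycle of q of the same length (via the bag equality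
--     of the cycle types) and sending p^t(r) ↦ q^t(partner r) gives a bijection u with
--     u∘p = q∘u; then ζ ↦ u ζ u⁻¹ permutes the m-cycles and preserves c(ζπ).
-- (2) If σ acts on M ≥ 1 points and lift σ adds a fixed point 0, then F_{lift σ} = M·F_σ:
--     an (M+1)-cycle ζ is the same as the M-cycle "ζ with 0 cut out" together with the
--     point after which 0 is inserted, and cutting 0 out of ζ·(lift σ) — where 0 is not
--     fixed — leaves c(ζ·lift σ) = c((cut ζ)·σ).
-- Iterating (2) k times gives F_{lift^k σ} = (n−1)⋯(n−k)·F_σ, and lift^k σ has type μ1^k,
-- so (1) transfers the identity to every π of that type.

module Submission where

open import Level using (0ℓ)
open import Data.Nat as ℕ using (ℕ; zero; suc; _+_; _*_; _∸_; _≤_; _<_; z≤n; s≤s; NonZero)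
open import Data.Nat.Properties as ℕ
  using (+-suc; +-comm; m∸n+n≡m; m+[n∸m]≡n; m<m+n; <⇒≤; ≤-trans; <-≤-trans; ≤-pred; n<1+n)
open import Data.Nat.Combinatorics using (_P_)
open import Data.Nat.Combinatorics.Base using (_P′_)
open import Data.Bool using (true)
open import Data.Nat.DivMod using (_%_; _/_; m≡m%n+[m/n]*n; m%n<n)
open import Data.Fin as Fin using (Fin; toℕ; fromℕ<)
open import Data.Fin.Properties as Fin using (pigeonhole; toℕ<n; toℕ-fromℕ<; toℕ-injective; any?)
open import Data.Vec using (Vec; []; _∷_; lookup; tabulate)
open import Data.Vec.Properties using (∷-injective; lookup∘tabulate; tabulate∘lookup; tabulate-cong)
open import Data.Fin.Permutation using (Permutation′; _⟨$⟩ʳ_; _⟨$⟩ˡ_; inverseˡ; lift₀)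
import Data.List
open import Data.List using (replicate; List; []; _∷_; map; filter; length; _++_; allFin; cartesianProduct; cartesianProductWith; concatMap)
open import Data.List.Properties using (++-identityʳ; length-map; length-++; length-tabulate; map-∘; map-id-local; filter-++; filter-all; filter-none; filter-≐; filter-accept; filter-reject; filter-some; map-tabulate; map-cong)
open import Data.List.Relation.Unary.All as All using (All; []; universal)
open import Data.List.Relation.Unary.All.Properties using (all-filter) renaming (map⁺ to All-map⁺; tabulate⁺ to All-tabulate⁺)
open import Data.List.Relation.Unary.Any using (here)
open import Data.List.Relation.Unary.AllPairs using ([]; _∷_)
open import Data.List.Relation.Unary.Unique.Propositional using (Unique)
import Data.List.Relation.Unary.Unique.Propositional.Properties as Unique
open import Data.List.Membership.Propositional using (_∈_; lose)
open import Data.List.Membership.Propositional.Properties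
  using (∈-map⁻; ∈-map⁺; map-∈↔; ∈-filter⁺; ∈-filter⁻; ∈-allFin; ∈-tabulate⁺; ∈-cartesianProductWith⁺; ∈-cartesianProduct⁺)
open import Data.List.Membership.Propositional.Properties.WithK using (unique∧set⇒bag; unique⇒irrelevant)
open import Data.List.Relation.Binary.BagAndSetEquality using (_∼[_]_; set; ∼bag⇒↭; ↭⇒∼bag)
open import Data.List.Relation.Binary.Permutation.Propositional using (_↭_; ↭-reflexive; ↭-trans; ↭-sym; ↭-prep)
open import Data.List.Relation.Binary.Permutation.Propositional.Properties using (↭-length; shift; ++⁺ʳ)
open import Data.Product using (Σ; ∃; _×_; _,_; proj₁; proj₂)
open import Function using (_∘_)
open import Function.Bundles using (mk⇔; _⇔_; Equivalence; _↔_; Inverse)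
open import Function.Construct.Symmetry using (↔-sym)
open import Function.Construct.Composition using (_↔-∘_)
open import Relation.Nullary using (yes; no; ¬_; contradiction)
open import Relation.Nullary.Decidable using (_×-dec_; map′)
open import Relation.Unary using (Pred; Decidable)
open import Relation.Binary using (tri<; tri≈; tri>)
open import Relation.Binary.PropositionalEquality
  using (_≡_; _≢_; _≗_; refl; sym; trans; cong; cong₂; subst; module ≡-Reasoning)
open import Defs

open ≡-Reasoning

private
  variable
    A B : Set

length-unique-same : {xs ys : List A} → Unique xs → Unique ys → xs ∼[ set ] ys → length xs ≡ length ys
length-unique-same xs! ys! same = ↭-length (∼bag⇒↭ (unique∧set⇒bag xs! ys! same))

count-bijection : {P : Pred A 0ℓ} {Q : Pred B 0ℓ} (P? : Decidable P) (Q? : Decidable Q)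
  (xs : List A) (ys : List B) → Unique xs → Unique ys →
  (∀ a → P a → a ∈ xs) → (∀ b → Q b → b ∈ ys) →
  (h : A → B) (g : B → A) → (∀ a → P a → Q (h a)) → (∀ b → Q b → P (g b)) →
  (∀ a → P a → g (h a) ≡ a) → (∀ b → Q b → h (g b) ≡ b) →
  length (filter P? xs) ≡ length (filter Q? ys)
count-bijection P? Q? xs ys xs! ys! xs-complete ys-complete h g PQ QP gh hg = begin
  length Ps              ≡⟨ length-map h Ps ⟨
  length (map h Ps)      ≡⟨ length-unique-same hPs! (Unique.filter⁺ Q? ys!) (mk⇔ to from) ⟩
  length (filter Q? ys)  ∎
  where
  Ps = filter P? xs
  -- g undoes h on Ps, so h has no collisions there
  hPs! : Unique (map h Ps)
  hPs! = Unique.map⁻ (subst Unique (sym ghPs) (Unique.filter⁺ P? xs!))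
    where
    ghPs : map g (map h Ps) ≡ Ps
    ghPs = trans (sym (map-∘ Ps)) (map-id-local (All.map (gh _) (all-filter P? xs)))
  to : ∀ {b} → b ∈ map h Ps → b ∈ filter Q? ys
  to b∈ with ∈-map⁻ h b∈
  ... | a , a∈ , refl = let Qha = PQ a (proj₂ (∈-filter⁻ P? {xs = xs} a∈)) in ∈-filter⁺ Q? (ys-complete _ Qha) Qha
  from : ∀ {b} → b ∈ filter Q? ys → b ∈ map h Ps
  from {b} b∈ = let Qb = proj₂ (∈-filter⁻ Q? {xs = ys} b∈) ; Pgb = QP b Qb in
    subst (_∈ map h Ps) (hg b Qb) (∈-map⁺ h (∈-filter⁺ P? (xs-complete _ Pgb) Pgb))

filter-cartesianProduct : {P : Pred A 0ℓ} (P? : Decidable P) (xs : List A) (ys : List B) →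
  filter (P? ∘ proj₁) (cartesianProduct xs ys) ≡ cartesianProduct (filter P? xs) ys
filter-cartesianProduct P? [] ys = refl
filter-cartesianProduct P? (x ∷ xs) ys with P? x
... | yes px = trans (filter-++ (P? ∘ proj₁) (map (x ,_) ys) _)
  (cong₂ _++_ (filter-all (P? ∘ proj₁) (All-map⁺ (universal (λ _ → px) ys))) (filter-cartesianProduct P? xs ys))
... | no ¬px = trans (filter-++ (P? ∘ proj₁) (map (x ,_) ys) _)
  (cong₂ _++_ (filter-none (P? ∘ proj₁) (All-map⁺ (universal (λ _ → ¬px) ys))) (filter-cartesianProduct P? xs ys))

length-cartesianProduct : (xs : List A) (ys : List B) → length (cartesianProduct xs ys) ≡ length xs * length ys
length-cartesianProduct [] ys = refl
length-cartesianProduct (x ∷ xs) ys = trans (length-++ (map (x ,_) ys))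
  (cong₂ _+_ (length-map (x ,_) ys) (length-cartesianProduct xs ys))

count-first : {P : Pred A 0ℓ} (P? : Decidable P) (xs : List A) (ys : List B) →
  length (filter (P? ∘ proj₁) (cartesianProduct xs ys)) ≡ length (filter P? xs) * length ys
count-first P? xs ys =
  trans (cong length (filter-cartesianProduct P? xs ys)) (length-cartesianProduct (filter P? xs) ys)

filter-map : {P : Pred B 0ℓ} (P? : Decidable P) (f : A → B) (xs : List A) →
  filter P? (map f xs) ≡ map f (filter (P? ∘ f) xs)
filter-map P? f [] = refl
filter-map P? f (x ∷ xs) with P? (f x)
... | yes _ = cong (f x ∷_) (filter-map P? f xs)
... | no _ = filter-map P? f xs

count-filter-filter-map : {P Q : Pred B 0ℓ} (P? : Decidable P) (Q? : Decidable Q) (f : A → B) (xs : List A) →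
  length (filter Q? (filter P? (map f xs))) ≡ length (filter (λ x → P? (f x) ×-dec Q? (f x)) xs)
count-filter-filter-map P? Q? f [] = refl
count-filter-filter-map P? Q? f (x ∷ xs) with P? (f x)
... | no _ = count-filter-filter-map P? Q? f xs
... | yes _ with Q? (f x)
...   | yes _ = cong suc (count-filter-filter-map P? Q? f xs)
...   | no _ = count-filter-filter-map P? Q? f xs

allVecs-step : ∀ m k → allVecs m (suc k) ≡ cartesianProductWith (λ v x → x ∷ v) (allVecs m k) (allFin m)
allVecs-step m k = go (allVecs m k)
  where
  go : ∀ vs → concatMap (λ v → map (_∷ v) (allFin m)) vs ≡ cartesianProductWith (λ v x → x ∷ v) vs (allFin m)
  go [] = refl
  go (v ∷ vs) = cong (map (_∷ v) (allFin m) ++_) (go vs)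

allVecs-complete : ∀ m k (v : Vec (Fin m) k) → v ∈ allVecs m k
allVecs-complete m zero [] = here refl
allVecs-complete m (suc k) (x ∷ v) rewrite allVecs-step m k =
  ∈-cartesianProductWith⁺ (λ v x → x ∷ v) (allVecs-complete m k v) (∈-allFin x)

allVecs-unique : ∀ m k → Unique (allVecs m k)
allVecs-unique m zero = [] ∷ []
allVecs-unique m (suc k) rewrite allVecs-step m k =
  Unique.cartesianProductWith⁺ (λ v x → x ∷ v) (λ e → let (x≡y , v≡w) = ∷-injective e in v≡w , x≡y)
    (allVecs-unique m k) (Unique.allFin⁺ m)

least : ∀ {n} (P : Pred (Fin n) 0ℓ) → Decidable P → (x : Fin n) → P x →
  Σ (Fin n) λ y → P y × (∀ z → P z → y Fin.≤ z)
least {suc n} P P? x px with P? Fin.zero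
... | yes p0 = Fin.zero , p0 , λ _ _ → z≤n
least {suc n} P P? Fin.zero px | no ¬p0 = contradiction px ¬p0
least {suc n} P P? (Fin.suc x) px | no ¬p0 with least (P ∘ Fin.suc) (P? ∘ Fin.suc) x px
... | y , py , y-least = Fin.suc y , py , suc-least
  where
  suc-least : ∀ z → P z → Fin.suc y Fin.≤ z
  suc-least Fin.zero pz = contradiction pz ¬p0
  suc-least (Fin.suc z) pz = s≤s (y-least z pz)

gap : ∀ {s t} → s < t → suc (t ∸ suc s) + s ≡ t
gap {s} {t} s<t = trans (sym (+-suc (t ∸ suc s) s)) (m∸n+n≡m s<t)

module Iterate {m : ℕ} (f : Fin m → Fin m) where

  iter-suc : ∀ t x → iter f (suc t) x ≡ f (iter f t x)
  iter-suc zero x = refl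
  iter-suc (suc t) x = iter-suc t (f x)

  iter-add : ∀ s t x → iter f (s + t) x ≡ iter f t (iter f s x)
  iter-add zero t x = refl
  iter-add (suc s) t x = iter-add s t (f x)

  iter-multiple : ∀ {o x} → iter f o x ≡ x → ∀ k → iter f (k * o) x ≡ x
  iter-multiple fix zero = refl
  iter-multiple {o} {x} fix (suc k) = begin
    iter f (o + k * o) x           ≡⟨ iter-add o (k * o) x ⟩
    iter f (k * o) (iter f o x)    ≡⟨ cong (iter f (k * o)) fix ⟩
    iter f (k * o) x               ≡⟨ iter-multiple fix k ⟩
    x                              ∎

  iter-periodic : ∀ {o x} .{{_ : NonZero o}} → iter f o x ≡ x → ∀ t → iter f t x ≡ iter f (t % o) x
  iter-periodic {o} {x} fix t = begin
    iter f t x                              ≡⟨ cong (λ u → iter f u x) (m≡m%n+[m/n]*n t o) ⟩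
    iter f (t % o + (t / o) * o) x          ≡⟨ cong (λ u → iter f u x) (+-comm (t % o) _) ⟩
    iter f ((t / o) * o + t % o) x          ≡⟨ iter-add ((t / o) * o) (t % o) x ⟩
    iter f (t % o) (iter f ((t / o) * o) x) ≡⟨ cong (iter f (t % o)) (iter-multiple fix (t / o)) ⟩
    iter f (t % o) x                        ∎

module Orbit {m : ℕ} (f : Fin m → Fin m) (f-inj : IsInjective f) where
  open Iterate f public

  iter-inj : ∀ t {x y} → iter f t x ≡ iter f t y → x ≡ y
  iter-inj zero e = e
  iter-inj (suc t) e = f-inj _ _ (iter-inj t e)

  Returns : Fin m → Fin m → Set
  Returns x t = iter f (suc (toℕ t)) x ≡ x

  -- Two of x, f x, …, f^m x coincide (pigeonhole), and injectivity turns
  -- f^i x ≡ f^j x into f^(j−i) x ≡ x.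
  returns : ∀ x → ∃ (Returns x)
  returns x with pigeonhole (n<1+n m) (λ (t : Fin (suc m)) → iter f (toℕ t) x)
  ... | i , j , i<j , fⁱx≡fʲx =
    fromℕ< d<m , subst (λ u → iter f (suc u) x ≡ x) (sym (toℕ-fromℕ< d<m)) (sym (iter-inj (toℕ i) fⁱx≡fⁱ[fᵈ⁺¹x]))
    where
    d = toℕ j ∸ suc (toℕ i)
    d<m : d < m
    d<m = <-≤-trans (subst (d <_) (trans (+-suc d (toℕ i)) (gap i<j)) (m<m+n d (s≤s z≤n))) (≤-pred (toℕ<n j))
    fⁱx≡fⁱ[fᵈ⁺¹x] : iter f (toℕ i) x ≡ iter f (toℕ i) (iter f (suc d) x)
    fⁱx≡fⁱ[fᵈ⁺¹x] = trans fⁱx≡fʲx (trans (cong (λ u → iter f u x) (sym (gap i<j))) (iter-add (suc d) (toℕ i) x))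

  first-return : ∀ x → Σ (Fin m) λ t → Returns x t × (∀ s → Returns x s → t Fin.≤ s)
  first-return x = least (Returns x) (λ t → iter f (suc (toℕ t)) x Fin.≟ x) (proj₁ (returns x)) (proj₂ (returns x))

  order : Fin m → ℕ
  order x = suc (toℕ (proj₁ (first-return x)))

  iter-order : ∀ x → iter f (order x) x ≡ x
  iter-order x = proj₁ (proj₂ (first-return x))

  order≤m : ∀ x → order x ≤ m
  order≤m x = toℕ<n (proj₁ (first-return x))

  order-minimal : ∀ x d → suc d < order x → iter f (suc d) x ≢ x
  order-minimal x d sd<o fix = ℕ.<-irrefl refl (<-≤-trans (≤-pred sd<o) t≤d)
    where
    d<m : d < m
    d<m = ℕ.<-trans (≤-pred sd<o) (toℕ<n (proj₁ (first-return x)))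
    t≤d : toℕ (proj₁ (first-return x)) ≤ d
    t≤d = subst (_ ≤_) (toℕ-fromℕ< d<m)
      (proj₂ (proj₂ (first-return x)) (fromℕ< d<m) (subst (λ u → iter f (suc u) x ≡ x) (sym (toℕ-fromℕ< d<m)) fix))

  orbit-distinct : ∀ x {a b} → a < b → b < order x → iter f a x ≢ iter f b x
  orbit-distinct x {a} {b} a<b b< fᵃx≡fᵇx =
    order-minimal x d (ℕ.≤-<-trans (subst (suc d ≤_) (gap a<b) (ℕ.m≤m+n (suc d) a)) b<) fᵈx≡x
    where
    d = b ∸ suc a
    fᵈx≡x : iter f (suc d) x ≡ x
    fᵈx≡x = sym (iter-inj a (trans fᵃx≡fᵇx (trans (cong (λ u → iter f u x) (sym (gap a<b))) (iter-add (suc d) a x))))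

  orbit-injective : ∀ x {s t} → s < order x → t < order x → iter f s x ≡ iter f t x → s ≡ t
  orbit-injective x {s} {t} s< t< e with ℕ.<-cmp s t
  ... | tri< s<t _ _ = contradiction e (orbit-distinct x s<t t<)
  ... | tri≈ _ s≡t _ = s≡t
  ... | tri> _ _ t<s = contradiction (sym e) (orbit-distinct x t<s s<)

  iter-mod : ∀ t x → iter f t x ≡ iter f (t % order x) x
  iter-mod t x = iter-periodic (iter-order x) t

  _~_ : Fin m → Fin m → Set
  x ~ y = ∃ λ t → iter f t x ≡ y

  ~-refl : ∀ {x} → x ~ x
  ~-refl = 0 , refl

  ~-trans : ∀ {x y z} → x ~ y → y ~ z → x ~ z
  ~-trans {x} (s , refl) (t , refl) = s + t , iter-add s t x

  -- Going once more around the cycle returns to the start.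
  ~-sym : ∀ {x y} → x ~ y → y ~ x
  ~-sym {x} (t , refl) = order x ∸ s , (begin
    iter f (order x ∸ s) (iter f t x)  ≡⟨ cong (iter f (order x ∸ s)) (iter-mod t x) ⟩
    iter f (order x ∸ s) (iter f s x)  ≡⟨ iter-add s (order x ∸ s) x ⟨
    iter f (s + (order x ∸ s)) x       ≡⟨ cong (λ u → iter f u x) (m+[n∸m]≡n (<⇒≤ (m%n<n t (order x)))) ⟩
    iter f (order x) x                 ≡⟨ iter-order x ⟩
    x                                  ∎)
    where s = t % order x

  ~⇒InOrbit : ∀ {x y} → x ~ y → InOrbit f x y
  ~⇒InOrbit {x} (t , refl) = fromℕ< s<m ,
    trans (cong (λ u → iter f u x) (toℕ-fromℕ< s<m)) (sym (iter-mod t x))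
    where s<m = <-≤-trans (m%n<n t (order x)) (order≤m x)

  InOrbit⇒~ : ∀ {x y} → InOrbit f x y → x ~ y
  InOrbit⇒~ (t , e) = toℕ t , e

  IsRep⇒least : ∀ {r} → IsRep f r → ∀ y → r ~ y → r Fin.≤ y
  IsRep⇒least {r} isr y r~y with ~⇒InOrbit r~y
  ... | t , e = subst (r Fin.≤_) e (isr t)

  least⇒IsRep : ∀ {r} → (∀ y → r ~ y → r Fin.≤ y) → IsRep f r
  least⇒IsRep r-least t = r-least _ (toℕ t , refl)

  rep-of : ∀ x → Σ (Fin m) λ r → x ~ r × (∀ z → x ~ z → r Fin.≤ z)
  rep-of x = least (x ~_) (λ y → map′ InOrbit⇒~ ~⇒InOrbit (inOrbit? f x y)) x ~-refl

  rep : Fin m → Fin m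
  rep x = proj₁ (rep-of x)

  ~rep : ∀ x → x ~ rep x
  ~rep x = proj₁ (proj₂ (rep-of x))

  rep-IsRep : ∀ x → IsRep f (rep x)
  rep-IsRep x = least⇒IsRep λ y r~y → proj₂ (proj₂ (rep-of x)) y (~-trans (~rep x) r~y)

  rep-unique : ∀ {x r} → IsRep f r → x ~ r → rep x ≡ r
  rep-unique {x} {r} isr x~r = Fin.≤-antisym (proj₂ (proj₂ (rep-of x)) r x~r)
    (IsRep⇒least isr (rep x) (~-trans (~-sym x~r) (~rep x)))

  -- The cycle length (the number of points in the orbit) is the order: the orbit of x is
  -- exactly the duplicate-free list x, f x, …, f^(order x − 1) x.
  cycleLength≡order : ∀ x → cycleLength f x ≡ order x
  cycleLength≡order x = begin
    length (filter (inOrbit? f x) (allFin m))  ≡⟨ length-unique-same (Unique.filter⁺ (inOrbit? f x) (Unique.allFin⁺ m)) orbit! same ⟩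
    length orbit                               ≡⟨ length-map _ (allFin (order x)) ⟩
    length (allFin (order x))                  ≡⟨ length-tabulate (λ s → s) ⟩
    order x                                    ∎
    where
    orbit : List (Fin m)
    orbit = map (λ (s : Fin (order x)) → iter f (toℕ s) x) (allFin (order x))
    orbit! : Unique orbit
    orbit! = Unique.map⁺ (λ e → toℕ-injective (orbit-injective x (toℕ<n _) (toℕ<n _) e)) (Unique.allFin⁺ _)
    to : ∀ {y} → y ∈ filter (inOrbit? f x) (allFin m) → y ∈ orbit
    to {y} y∈ with InOrbit⇒~ (proj₂ (∈-filter⁻ (inOrbit? f x) {xs = allFin m} y∈))
    ... | t , refl = subst (_∈ orbit) (trans (cong (λ u → iter f u x) (toℕ-fromℕ< s<o)) (sym (iter-mod t x)))
      (∈-map⁺ _ (∈-allFin (fromℕ< s<o)))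
      where s<o = m%n<n t (order x)
    from : ∀ {y} → y ∈ orbit → y ∈ filter (inOrbit? f x) (allFin m)
    from {y} y∈ = let (s , _ , y≡fˢx) = ∈-map⁻ (λ (s : Fin (order x)) → iter f (toℕ s) x) {xs = allFin (order x)} y∈ in
      ∈-filter⁺ (inOrbit? f x) (∈-allFin y) (~⇒InOrbit (toℕ s , sym y≡fˢx))
    same : filter (inOrbit? f x) (allFin m) ∼[ set ] orbit
    same = mk⇔ to from

  offset : Fin m → ℕ
  offset x = proj₁ (~-sym (~rep x)) % order (rep x)

  offset<order : ∀ x → offset x < order (rep x)
  offset<order x = m%n<n (proj₁ (~-sym (~rep x))) (order (rep x))

  iter-offset : ∀ x → iter f (offset x) (rep x) ≡ x
  iter-offset x = trans (sym (iter-mod (proj₁ (~-sym (~rep x))) (rep x))) (proj₂ (~-sym (~rep x)))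

  rep-iter : ∀ {r} → IsRep f r → ∀ t → rep (iter f t r) ≡ r
  rep-iter isr t = rep-unique isr (~-sym (t , refl))

  offset-iter : ∀ {r} → IsRep f r → ∀ t → offset (iter f t r) ≡ t % order r
  offset-iter {r} isr t = orbit-injective (rep y) (offset<order y) s<o (begin
    iter f (offset y) (rep y)     ≡⟨ iter-offset y ⟩
    iter f t r                    ≡⟨ iter-mod t r ⟩
    iter f (t % order r) r        ≡⟨ cong (iter f (t % order r)) (rep-iter isr t) ⟨
    iter f (t % order r) (rep y)  ∎)
    where
    y = iter f t r
    s<o : t % order r < order (rep y)
    s<o = subst (λ z → t % order r < order z) (sym (rep-iter isr t)) (m%n<n t (order r))

iter-cong : ∀ {m} {f g : Fin m → Fin m} → f ≗ g → ∀ t x → iter f t x ≡ iter g t x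
iter-cong f≗g zero x = refl
iter-cong {g = g} f≗g (suc t) x = trans (cong (iter _ t) (f≗g x)) (iter-cong f≗g t (g x))

cycles-cong : ∀ {m} {f g : Fin m → Fin m} → f ≗ g → cycles f ≡ cycles g
cycles-cong {m} {f} {g} f≗g = cong length (filter-≐ (isRep? f) (isRep? g) (rep-f⇒g , rep-g⇒f) (allFin m))
  where
  rep-f⇒g : ∀ {x} → IsRep f x → IsRep g x
  rep-f⇒g {x} isr t = subst (x Fin.≤_) (iter-cong f≗g (toℕ t) x) (isr t)
  rep-g⇒f : ∀ {x} → IsRep g x → IsRep f x
  rep-g⇒f {x} isr t = subst (x Fin.≤_) (sym (iter-cong f≗g (toℕ t) x)) (isr t)

injective-cong : ∀ {m} {f g : Fin m → Fin m} → f ≗ g → IsInjective f → IsInjective g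
injective-cong f≗g f-inj i j gi≡gj = f-inj i j (trans (f≗g i) (trans gi≡gj (sym (f≗g j))))

mcycle-cong : ∀ {m} {f g : Fin m → Fin m} → f ≗ g → IsMCycle f → IsMCycle g
mcycle-cong f≗g (f-inj , one) = injective-cong f≗g f-inj , trans (sym (cycles-cong f≗g)) one

expo-cong : ∀ {m} (π : Permutation′ m) {f g : Fin m → Fin m} → f ≗ g → expo π f ≡ expo π g
expo-cong π f≗g = cong (λ c → (c ∸ 1) / 2) (cycles-cong (cong (π ⟨$⟩ʳ_) ∘ f≗g))

permutation-inj : ∀ {m} (π : Permutation′ m) → IsInjective (π ⟨$⟩ʳ_)
permutation-inj π i j e = trans (sym (inverseˡ π)) (trans (cong (π ⟨$⟩ˡ_) e) (inverseˡ π))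

product-inj : ∀ {m} (ζ : Fin m → Fin m) (π : Permutation′ m) → IsInjective ζ → IsInjective (ζ · π)
product-inj ζ π ζ-inj i j e = ζ-inj i j (permutation-inj π _ _ e)

-- Two permutations have equally many cycles when there are maps α, β between their
-- underlying sets sending cycles into cycles and inverse to each other up to staying on
-- the same cycle: x ↦ rep(α x) is then a bijection between the cycle representatives.
cycles-matching : ∀ {a b} (f : Fin a → Fin a) (g : Fin b → Fin b) (f-inj : IsInjective f) (g-inj : IsInjective g)
  (α : Fin a → Fin b) (β : Fin b → Fin a) →
  (∀ {x y} → Orbit._~_ f f-inj x y → Orbit._~_ g g-inj (α x) (α y)) →
  (∀ {x y} → Orbit._~_ g g-inj x y → Orbit._~_ f f-inj (β x) (β y)) →
  (∀ x → Orbit._~_ f f-inj (β (α x)) x) → (∀ y → Orbit._~_ g g-inj (α (β y)) y) →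
  cycles f ≡ cycles g
cycles-matching {a} {b} f g f-inj g-inj α β α~ β~ βα~ αβ~ =
  count-bijection (isRep? f) (isRep? g) (allFin a) (allFin b) (Unique.allFin⁺ a) (Unique.allFin⁺ b)
    (λ x _ → ∈-allFin x) (λ y _ → ∈-allFin y) (G.rep ∘ α) (F.rep ∘ β)
    (λ x _ → G.rep-IsRep (α x)) (λ y _ → F.rep-IsRep (β y)) βα-rep αβ-rep
  where
  module F = Orbit f f-inj
  module G = Orbit g g-inj
  βα-rep : ∀ x → IsRep f x → F.rep (β (G.rep (α x))) ≡ x
  βα-rep x isr = F.rep-unique isr (F.~-trans (F.~-sym (β~ (G.~rep (α x)))) (βα~ x))
  αβ-rep : ∀ y → IsRep g y → G.rep (α (F.rep (β y))) ≡ y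
  αβ-rep y isr = G.rep-unique isr (G.~-trans (G.~-sym (α~ (F.~rep (β y)))) (αβ~ y))

Counted : ∀ {n} → Permutation′ n → ℕ → Vec (Fin n) n → Set
Counted π j v = IsMCycle (lookup v) × expo π (lookup v) ≡ j

counted? : ∀ {n} (π : Permutation′ n) j → Decidable (Counted π j)
counted? π j v = isMCycle? (lookup v) ×-dec (expo π (lookup v) ℕ.≟ j)

F-as-count : ∀ {n} (π : Permutation′ n) j → F π j ≡ length (filter (counted? π j) (allVecs n n))
F-as-count {n} π j = count-filter-filter-map isMCycle? (λ ζ → expo π ζ ℕ.≟ j) lookup (allVecs n n)

F-by-bijection : ∀ {a b} (π : Permutation′ a) (π′ : Permutation′ b) j
  (h : Vec (Fin a) a → Vec (Fin b) b) (g : Vec (Fin b) b → Vec (Fin a) a) →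
  (∀ v → Counted π j v → Counted π′ j (h v)) → (∀ w → Counted π′ j w → Counted π j (g w)) →
  (∀ v → Counted π j v → g (h v) ≡ v) → (∀ w → Counted π′ j w → h (g w) ≡ w) →
  F π j ≡ F π′ j
F-by-bijection {a} {b} π π′ j h g hc gc gh hg = begin
  F π j                                          ≡⟨ F-as-count π j ⟩
  length (filter (counted? π j) (allVecs a a))   ≡⟨ count-bijection (counted? π j) (counted? π′ j) (allVecs a a) (allVecs b b)
                                                      (allVecs-unique a a) (allVecs-unique b b)
                                                      (λ v _ → allVecs-complete a a v) (λ w _ → allVecs-complete b b w)
                                                      h g hc gc gh hg ⟩
  length (filter (counted? π′ j) (allVecs b b))  ≡⟨ F-as-count π′ j ⟨
  F π′ j                                         ∎

module Conjugation {m} (u u⁻ : Fin m → Fin m) (u⁻u : ∀ x → u⁻ (u x) ≡ x) (uu⁻ : ∀ x → u (u⁻ x) ≡ x) where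

  conj : (Fin m → Fin m) → Fin m → Fin m
  conj ζ x = u (ζ (u⁻ x))

  u-inj : IsInjective u
  u-inj a b e = trans (sym (u⁻u a)) (trans (cong u⁻ e) (u⁻u b))

  u⁻-inj : IsInjective u⁻
  u⁻-inj a b e = trans (sym (uu⁻ a)) (trans (cong u e) (uu⁻ b))

  conj-inj : ∀ ζ → IsInjective ζ → IsInjective (conj ζ)
  conj-inj ζ ζ-inj a b e = u⁻-inj a b (ζ-inj _ _ (u-inj _ _ e))

  iter-conj : ∀ ζ t x → iter (conj ζ) t (u x) ≡ u (iter ζ t x)
  iter-conj ζ zero x = refl
  iter-conj ζ (suc t) x = trans (cong (λ y → iter (conj ζ) t (u (ζ y))) (u⁻u x)) (iter-conj ζ t (ζ x))

  iter-conj⁻ : ∀ ζ t x → iter ζ t (u⁻ x) ≡ u⁻ (iter (conj ζ) t x)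
  iter-conj⁻ ζ t x = begin
    iter ζ t (u⁻ x)                     ≡⟨ u⁻u _ ⟨
    u⁻ (u (iter ζ t (u⁻ x)))            ≡⟨ cong u⁻ (iter-conj ζ t (u⁻ x)) ⟨
    u⁻ (iter (conj ζ) t (u (u⁻ x)))     ≡⟨ cong (u⁻ ∘ iter (conj ζ) t) (uu⁻ x) ⟩
    u⁻ (iter (conj ζ) t x)              ∎

  cycles-conj : ∀ ζ → IsInjective ζ → cycles ζ ≡ cycles (conj ζ)
  cycles-conj ζ ζ-inj = cycles-matching ζ (conj ζ) ζ-inj (conj-inj ζ ζ-inj) u u⁻
    (λ {x} (t , e) → t , trans (iter-conj ζ t x) (cong u e))
    (λ {x} (t , e) → t , trans (iter-conj⁻ ζ t x) (cong u⁻ e))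
    (λ x → 0 , u⁻u x) (λ y → 0 , uu⁻ y)

  conj-product : ∀ (π π′ : Permutation′ m) → (∀ x → u (π ⟨$⟩ʳ x) ≡ π′ ⟨$⟩ʳ u x) →
    ∀ ζ → conj ζ · π′ ≗ conj (ζ · π)
  conj-product π π′ intertwine ζ x = sym (intertwine (ζ (u⁻ x)))

  conj-counted : ∀ (π π′ : Permutation′ m) → (∀ x → u (π ⟨$⟩ʳ x) ≡ π′ ⟨$⟩ʳ u x) →
    ∀ j v → Counted π j v → Counted π′ j (tabulate (conj (lookup v)))
  conj-counted π π′ intertwine j v ((ζ-inj , one) , expo≡j) =
    mcycle-cong (sym ∘ lookup∘tabulate (conj ζ)) (conj-inj ζ ζ-inj , trans (sym (cycles-conj ζ ζ-inj)) one) ,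
    (begin
      expo π′ (lookup (tabulate (conj ζ)))  ≡⟨ expo-cong π′ (lookup∘tabulate (conj ζ)) ⟩
      (cycles (conj ζ · π′) ∸ 1) / 2        ≡⟨ cong (λ c → (c ∸ 1) / 2) (cycles-cong (conj-product π π′ intertwine ζ)) ⟩
      (cycles (conj (ζ · π)) ∸ 1) / 2       ≡⟨ cong (λ c → (c ∸ 1) / 2) (cycles-conj (ζ · π) (product-inj ζ π ζ-inj)) ⟨
      expo π ζ                              ≡⟨ expo≡j ⟩
      j                                     ∎)
    where ζ = lookup v

-- Conjugate permutations have the same IO-polynomial: ζ ↦ u ζ u⁻¹ is a bijection of
-- the m-cycles which preserves the cycle count of the product.
F-conjugate : ∀ {m} (π π′ : Permutation′ m) (u u⁻ : Fin m → Fin m) →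
  (∀ x → u⁻ (u x) ≡ x) → (∀ x → u (u⁻ x) ≡ x) → (∀ x → u (π ⟨$⟩ʳ x) ≡ π′ ⟨$⟩ʳ u x) →
  ∀ j → F π j ≡ F π′ j
F-conjugate {m} π π′ u u⁻ u⁻u uu⁻ intertwine j =
  F-by-bijection π π′ j (tabulate ∘ C.conj ∘ lookup) (tabulate ∘ C⁻.conj ∘ lookup)
    (C.conj-counted π π′ intertwine j) (C⁻.conj-counted π′ π intertwine⁻ j)
    (λ v _ → conj-conj⁻ u u⁻ u⁻u v) (λ w _ → conj-conj⁻ u⁻ u uu⁻ w)
  where
  module C = Conjugation u u⁻ u⁻u uu⁻
  module C⁻ = Conjugation u⁻ u uu⁻ u⁻u
  intertwine⁻ : ∀ y → u⁻ (π′ ⟨$⟩ʳ y) ≡ π ⟨$⟩ʳ u⁻ y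
  intertwine⁻ y = begin
    u⁻ (π′ ⟨$⟩ʳ y)          ≡⟨ cong (λ z → u⁻ (π′ ⟨$⟩ʳ z)) (uu⁻ y) ⟨
    u⁻ (π′ ⟨$⟩ʳ u (u⁻ y))   ≡⟨ cong u⁻ (intertwine (u⁻ y)) ⟨
    u⁻ (u (π ⟨$⟩ʳ u⁻ y))    ≡⟨ u⁻u _ ⟩
    π ⟨$⟩ʳ u⁻ y             ∎
  conj-conj⁻ : ∀ (a b : Fin m → Fin m) → (∀ x → b (a x) ≡ x) → ∀ v →
    tabulate (λ x → b (lookup (tabulate (λ y → a (lookup v (b y)))) (a x))) ≡ v
  conj-conj⁻ a b ba v = trans (tabulate-cong λ x →
      trans (cong b (lookup∘tabulate _ (a x))) (trans (ba _) (cong (lookup v) (ba x))))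
    (tabulate∘lookup v)

-- A conjugator from a choice of partner cycles: if B sends each representative r of a
-- cycle of p to the representative of a cycle of q of the same length, then
-- τ(p^t r) = q^t(B r) is well defined and intertwines p with q.
module Conjugator {m} (p q : Fin m → Fin m) (p-inj : IsInjective p) (q-inj : IsInjective q)
  (B : Fin m → Fin m) (B-rep : ∀ r → IsRep p r → IsRep q (B r))
  (B-order : ∀ r → IsRep p r → Orbit.order q q-inj (B r) ≡ Orbit.order p p-inj r) where
  private
    module P = Orbit p p-inj
    module Q = Orbit q q-inj

  τ : Fin m → Fin m
  τ x = iter q (P.offset x) (B (P.rep x))

  τ-iter : ∀ {r} → IsRep p r → ∀ t → τ (iter p t r) ≡ iter q t (B r)
  τ-iter {r} isr t = begin
    iter q (P.offset y) (B (P.rep y))  ≡⟨ cong₂ (λ s z → iter q s (B z)) (P.offset-iter isr t) (P.rep-iter isr t) ⟩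
    iter q (t % P.order r) (B r)       ≡⟨ Q.iter-periodic qᵒBr≡Br t ⟨
    iter q t (B r)                     ∎
    where
    y = iter p t r
    qᵒBr≡Br : iter q (P.order r) (B r) ≡ B r
    qᵒBr≡Br = trans (cong (λ o → iter q o (B r)) (sym (B-order r isr))) (Q.iter-order (B r))

  τ-intertwines : ∀ x → τ (p x) ≡ q (τ x)
  τ-intertwines x = begin
    τ (p x)                   ≡⟨ cong (τ ∘ p) (P.iter-offset x) ⟨
    τ (p (iter p o r))        ≡⟨ cong τ (P.iter-suc o r) ⟨
    τ (iter p (suc o) r)      ≡⟨ τ-iter (P.rep-IsRep x) (suc o) ⟩
    iter q (suc o) (B r)      ≡⟨ Q.iter-suc o (B r) ⟩
    q (τ x)                   ∎
    where
    o = P.offset x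
    r = P.rep x

conjugator-inverse : ∀ {m} (p q : Fin m → Fin m) (p-inj : IsInjective p) (q-inj : IsInjective q)
  (B B′ : Fin m → Fin m) (B-rep : ∀ r → IsRep p r → IsRep q (B r)) (B′-rep : ∀ r → IsRep q r → IsRep p (B′ r))
  (B-order : ∀ r → IsRep p r → Orbit.order q q-inj (B r) ≡ Orbit.order p p-inj r)
  (B′-order : ∀ r → IsRep q r → Orbit.order p p-inj (B′ r) ≡ Orbit.order q q-inj r) →
  (∀ r → IsRep p r → B′ (B r) ≡ r) →
  ∀ x → Conjugator.τ q p q-inj p-inj B′ B′-rep B′-order (Conjugator.τ p q p-inj q-inj B B-rep B-order x) ≡ x
conjugator-inverse {m} p q p-inj q-inj B B′ B-rep B′-rep B-order B′-order B′B x = begin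
  τ′ (iter q o (B r))   ≡⟨ Conjugator.τ-iter q p q-inj p-inj B′ B′-rep B′-order (B-rep r isr) o ⟩
  iter p o (B′ (B r))   ≡⟨ cong (iter p o) (B′B r isr) ⟩
  iter p o r            ≡⟨ P.iter-offset x ⟩
  x                     ∎
  where
  module P = Orbit p p-inj
  τ′ : Fin m → Fin m
  τ′ = Conjugator.τ q p q-inj p-inj B′ B′-rep B′-order
  o = P.offset x
  r = P.rep x
  isr = P.rep-IsRep x

reps : ∀ {m} → (Fin m → Fin m) → List (Fin m)
reps f = filter (isRep? f) (allFin _)

CyclesOfLength : ∀ {m} → (Fin m → Fin m) → ℕ → Set
CyclesOfLength f L = ∃ λ r → r ∈ reps f × L ≡ cycleLength f r

reps-unique : ∀ {m} (f : Fin m → Fin m) → Unique (reps f)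
reps-unique {m} f = Unique.filter⁺ (isRep? f) (Unique.allFin⁺ m)

module Partner {m} (p q : Fin m → Fin m) (M : ∀ {L} → CyclesOfLength p L ↔ CyclesOfLength q L) where

  partner-cycle : ∀ {r} → r ∈ reps p → CyclesOfLength q (cycleLength p r)
  partner-cycle r∈ = Inverse.to M (_ , r∈ , refl)

  partner : Fin m → Fin m
  partner r with isRep? p r
  ... | yes isr = proj₁ (partner-cycle (∈-filter⁺ (isRep? p) (∈-allFin r) isr))
  ... | no _ = r

  -- membership proofs in a duplicate-free list are unique, so any proof gives the same partner
  partner-spec : ∀ {r} (r∈ : r ∈ reps p) → partner r ≡ proj₁ (partner-cycle r∈)
  partner-spec {r} r∈ with isRep? p r
  ... | yes isr = cong (proj₁ ∘ partner-cycle) (unique⇒irrelevant (reps-unique p) _ r∈)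
  ... | no ¬isr = contradiction (proj₂ (∈-filter⁻ (isRep? p) {xs = allFin m} r∈)) ¬isr

  rep∈ : ∀ {r} → IsRep p r → r ∈ reps p
  rep∈ {r} = ∈-filter⁺ (isRep? p) (∈-allFin r)

  partner-rep : ∀ r → IsRep p r → IsRep q (partner r)
  partner-rep r isr = subst (IsRep q) (sym (partner-spec (rep∈ isr)))
    (proj₂ (∈-filter⁻ (isRep? q) {xs = allFin m} (proj₁ (proj₂ (partner-cycle (rep∈ isr))))))

  partner-length : ∀ r → IsRep p r → cycleLength q (partner r) ≡ cycleLength p r
  partner-length r isr = subst (λ s → cycleLength q s ≡ cycleLength p r) (sym (partner-spec (rep∈ isr)))
    (sym (proj₂ (proj₂ (partner-cycle (rep∈ isr)))))

partner-inverse : ∀ {m} (p q : Fin m → Fin m) (M : ∀ {L} → CyclesOfLength p L ↔ CyclesOfLength q L) →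
  ∀ r → IsRep p r → Partner.partner q p (↔-sym M) (Partner.partner p q M r) ≡ r
partner-inverse {m} p q M r isr with Partner.partner-cycle p q M (Partner.rep∈ p q M isr) in eq
... | s , s∈ , e = begin
  Partner.partner q p (↔-sym M) (Partner.partner p q M r)  ≡⟨ cong (Partner.partner q p (↔-sym M)) (trans (Partner.partner-spec p q M r∈) (cong proj₁ eq)) ⟩
  Partner.partner q p (↔-sym M) s                          ≡⟨ Partner.partner-spec q p (↔-sym M) s∈ ⟩
  proj₁ (Inverse.from M (s , s∈ , refl))                   ≡⟨ along e ⟨
  proj₁ (Inverse.from M (s , s∈ , e))                      ≡⟨ cong (proj₁ ∘ Inverse.from M) eq ⟨
  proj₁ (Inverse.from M (Inverse.to M (r , r∈ , refl)))    ≡⟨ cong proj₁ (Inverse.strictlyInverseʳ M _) ⟩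
  r                                                        ∎
  where
  r∈ = Partner.rep∈ p q M isr
  along : ∀ {L} (e : L ≡ cycleLength q s) → proj₁ (Inverse.from M (s , s∈ , e)) ≡ proj₁ (Inverse.from M (s , s∈ , refl))
  along refl = refl

-- Permutations of the same cycle type are conjugate, so their IO-polynomials agree
-- (this is the fact that F_π depends only on the type of π).
F-type : ∀ {m} (π π′ : Permutation′ m) → cycleType (π ⟨$⟩ʳ_) ↭ cycleType (π′ ⟨$⟩ʳ_) → ∀ j → F π j ≡ F π′ j
F-type {m} π π′ same-type = F-conjugate π π′ τ τ′
  (conjugator-inverse p p′ p-inj p′-inj pick pick′ pick-rep pick′-rep pick-order pick′-order (partner-inverse p p′ M))
  (conjugator-inverse p′ p p′-inj p-inj pick′ pick pick′-rep pick-rep pick′-order pick-order (partner-inverse p′ p (↔-sym M)))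
  (Conjugator.τ-intertwines p p′ p-inj p′-inj pick pick-rep pick-order)
  where
  p p′ : Fin m → Fin m
  p = π ⟨$⟩ʳ_
  p′ = π′ ⟨$⟩ʳ_
  p-inj : IsInjective p
  p-inj = permutation-inj π
  p′-inj : IsInjective p′
  p′-inj = permutation-inj π′
  -- a cycle of length L of p ↔ a copy of L in the cycle type of p ↔ … of p′ ↔ a cycle of p′
  M : ∀ {L} → CyclesOfLength p L ↔ CyclesOfLength p′ L
  M = ↔-sym (map-∈↔ (cycleLength p′)) ↔-∘ (↭⇒∼bag same-type ↔-∘ map-∈↔ (cycleLength p))
  pick pick′ : Fin m → Fin m
  pick = Partner.partner p p′ M
  pick′ = Partner.partner p′ p (↔-sym M)
  pick-rep : ∀ r → IsRep p r → IsRep p′ (pick r)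
  pick-rep = Partner.partner-rep p p′ M
  pick′-rep : ∀ r → IsRep p′ r → IsRep p (pick′ r)
  pick′-rep = Partner.partner-rep p′ p (↔-sym M)
  pick-order : ∀ r → IsRep p r → Orbit.order p′ p′-inj (pick r) ≡ Orbit.order p p-inj r
  pick-order r isr = trans (sym (Orbit.cycleLength≡order p′ p′-inj (pick r)))
    (trans (Partner.partner-length p p′ M r isr) (Orbit.cycleLength≡order p p-inj r))
  pick′-order : ∀ r → IsRep p′ r → Orbit.order p p-inj (pick′ r) ≡ Orbit.order p′ p′-inj r
  pick′-order r isr = trans (sym (Orbit.cycleLength≡order p p-inj (pick′ r)))
    (trans (Partner.partner-length p′ p (↔-sym M) r isr) (Orbit.cycleLength≡order p′ p′-inj r))
  τ τ′ : Fin m → Fin m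
  τ = Conjugator.τ p p′ p-inj p′-inj pick pick-rep pick-order
  τ′ = Conjugator.τ p′ p p′-inj p-inj pick′ pick′-rep pick′-order

lower : ∀ {m} → Fin m → Fin (suc m) → Fin m
lower d Fin.zero = d
lower d (Fin.suc j) = j

lower-inj : ∀ {m} {d : Fin m} {x y} → x ≢ Fin.suc d → y ≢ Fin.suc d → lower d x ≡ lower d y → x ≡ y
lower-inj {x = Fin.zero} {Fin.zero} _ _ _ = refl
lower-inj {x = Fin.zero} {Fin.suc y} _ y≢ d≡y = contradiction (cong Fin.suc (sym d≡y)) y≢
lower-inj {x = Fin.suc x} {Fin.zero} x≢ _ x≡d = contradiction (cong Fin.suc x≡d) x≢
lower-inj {x = Fin.suc x} {Fin.suc y} _ _ x≡y = cong Fin.suc x≡y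

-- Cutting the point 0 out of its cycle: the predecessor of 0 is sent to the successor of 0.
cut : ∀ {m} → (Fin (suc m) → Fin (suc m)) → Fin m → Fin m
cut f i = lower (lower i (f Fin.zero)) (f (Fin.suc i))

insert : ∀ {m} → (Fin m → Fin m) → Fin m → Fin (suc m) → Fin (suc m)
insert h a Fin.zero = Fin.suc (h a)
insert h a (Fin.suc i) with i Fin.≟ a
... | yes _ = Fin.zero
... | no _ = Fin.suc (h i)

insert-at : ∀ {m} (h : Fin m → Fin m) a → insert h a (Fin.suc a) ≡ Fin.zero
insert-at h a with a Fin.≟ a
... | yes _ = refl
... | no a≢a = contradiction refl a≢a

insert-cong : ∀ {m} {h h′ : Fin m → Fin m} → h ≗ h′ → ∀ a → insert h a ≗ insert h′ a
insert-cong h≗h′ a Fin.zero = cong Fin.suc (h≗h′ a)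
insert-cong h≗h′ a (Fin.suc i) with i Fin.≟ a
... | yes _ = refl
... | no _ = cong Fin.suc (h≗h′ i)

insert-inj : ∀ {m} (h : Fin m → Fin m) a → IsInjective h → IsInjective (insert h a)
insert-inj h a h-inj Fin.zero Fin.zero _ = refl
insert-inj h a h-inj Fin.zero (Fin.suc i) e with i Fin.≟ a
... | yes _ = contradiction e λ ()
... | no i≢a = contradiction (sym (h-inj _ _ (Fin.suc-injective e))) i≢a
insert-inj h a h-inj (Fin.suc i) Fin.zero e with i Fin.≟ a
... | yes _ = contradiction e λ ()
... | no i≢a = contradiction (h-inj _ _ (Fin.suc-injective e)) i≢a
insert-inj h a h-inj (Fin.suc i) (Fin.suc i′) e with i Fin.≟ a | i′ Fin.≟ a
... | yes refl | yes refl = refl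
... | yes _ | no _ = contradiction e λ ()
... | no _ | yes _ = contradiction e λ ()
... | no _ | no _ = cong Fin.suc (h-inj _ _ (Fin.suc-injective e))

cut-insert : ∀ {m} (h : Fin m → Fin m) a → cut (insert h a) ≗ h
cut-insert h a i with i Fin.≟ a
... | yes refl = refl
... | no _ = refl

insert-cut : ∀ {m} (f : Fin (suc m) → Fin (suc m)) → IsInjective f → ∀ {a j₀} →
  f (Fin.suc a) ≡ Fin.zero → f Fin.zero ≡ Fin.suc j₀ → insert (cut f) a ≗ f
insert-cut f f-inj {a} fa≡0 f0≡j₀ Fin.zero rewrite fa≡0 | f0≡j₀ = refl
insert-cut f f-inj {a} fa≡0 f0≡j₀ (Fin.suc i) with i Fin.≟ a
... | yes refl = sym fa≡0
... | no i≢a with f (Fin.suc i) in fi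
...   | Fin.zero = contradiction (Fin.suc-injective (f-inj _ _ (trans fi (sym fa≡0)))) i≢a
...   | Fin.suc k = refl

-- Cutting 0 out of a permutation f that moves 0 gives a permutation with the same number
-- of cycles: the cycles of cut f are those of f with 0 deleted.
module Cut {m} (f : Fin (suc m) → Fin (suc m)) (f-inj : IsInjective f) {j₀} (f0≡j₀ : f Fin.zero ≡ Fin.suc j₀) where
  g : Fin m → Fin m
  g = cut f

  cut-lower : ∀ c → g c ≡ lower j₀ (f (Fin.suc c))
  cut-lower c rewrite f0≡j₀ = refl

  cut-inj : IsInjective g
  cut-inj i i′ e = Fin.suc-injective (f-inj _ _ (lower-inj (avoids i) (avoids i′)
      (trans (sym (cut-lower i)) (trans e (cut-lower i′)))))
    where
    avoids : ∀ c → f (Fin.suc c) ≢ Fin.suc j₀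
    avoids c e′ = contradiction (f-inj _ _ (trans e′ (sym f0≡j₀))) λ ()

  private
    module F = Orbit f f-inj
    module G = Orbit g cut-inj

  -- one step of g is one step of f, or two when passing through 0
  ~-into-step : ∀ a → Fin.suc a F.~ Fin.suc (g a)
  ~-into-step a with f (Fin.suc a) in fa
  ... | Fin.suc j = 1 , fa
  ... | Fin.zero = 2 , trans (cong f fa) (trans f0≡j₀ (cong (Fin.suc ∘ lower a) (sym f0≡j₀)))

  ~-into : ∀ {a b} → a G.~ b → Fin.suc a F.~ Fin.suc b
  ~-into (zero , refl) = F.~-refl
  ~-into {a} (suc t , e) = F.~-trans (~-into-step a) (~-into (t , e))

  ~-back-iter : ∀ a t → a G.~ lower j₀ (iter f t (Fin.suc a))
  ~-back-iter a zero = G.~-refl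
  ~-back-iter a (suc t) = subst (λ x → a G.~ lower j₀ x) (sym (F.iter-suc t (Fin.suc a))) (step (iter f t (Fin.suc a)) (~-back-iter a t))
    where
    step : ∀ x → a G.~ lower j₀ x → a G.~ lower j₀ (f x)
    step Fin.zero a~j₀ = subst (λ y → a G.~ lower j₀ y) (sym f0≡j₀) a~j₀
    step (Fin.suc c) a~c = G.~-trans a~c (1 , cut-lower c)

  ~-back : ∀ {a b} → Fin.suc a F.~ Fin.suc b → a G.~ b
  ~-back {a} (t , e) = subst (λ x → a G.~ lower j₀ x) e (~-back-iter a t)

  suc-lower~ : ∀ x → Fin.suc (lower j₀ x) F.~ x
  suc-lower~ Fin.zero = F.~-sym (1 , f0≡j₀)
  suc-lower~ (Fin.suc i) = F.~-refl

  cycles-cut : cycles f ≡ cycles g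
  cycles-cut = cycles-matching f g f-inj cut-inj (lower j₀) Fin.suc
    (λ {x} {y} x~y → ~-back (F.~-trans (suc-lower~ x) (F.~-trans x~y (F.~-sym (suc-lower~ y)))))
    ~-into suc-lower~ (λ _ → G.~-refl)

cut-cong : ∀ {m} {f g : Fin (suc m) → Fin (suc m)} → f ≗ g → cut f ≗ cut g
cut-cong f≗g i = cong₂ (λ a b → lower (lower i a) b) (f≗g Fin.zero) (f≗g (Fin.suc i))

-- Cutting 0 commutes with multiplying by the lift of σ, which fixes 0; hence the cycle
-- count of ζ·(lift σ) is that of (cut ζ)·σ.
cut-product : ∀ {m} (σ : Permutation′ m) (ζ : Fin (suc m) → Fin (suc m)) {j₀} →
  ζ Fin.zero ≡ Fin.suc j₀ → cut (ζ · lift₀ σ) ≗ cut ζ · σ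
cut-product σ ζ ζ0≡j₀ i rewrite ζ0≡j₀ with ζ (Fin.suc i)
... | Fin.suc k = refl
... | Fin.zero = refl

cycles-product-cut : ∀ {m} (σ : Permutation′ m) (ζ : Fin (suc m) → Fin (suc m)) → IsInjective ζ → ∀ {j₀} →
  ζ Fin.zero ≡ Fin.suc j₀ → cycles (ζ · lift₀ σ) ≡ cycles (cut ζ · σ)
cycles-product-cut σ ζ ζ-inj ζ0≡j₀ =
  trans (Cut.cycles-cut (ζ · lift₀ σ) (product-inj ζ (lift₀ σ) ζ-inj) (cong (lift₀ σ ⟨$⟩ʳ_) ζ0≡j₀))
    (cycles-cong (cut-product σ ζ ζ0≡j₀))

nonzero : ∀ {m} (x : Fin (suc m)) → x ≢ Fin.zero → ∃ λ y → x ≡ Fin.suc y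
nonzero Fin.zero x≢0 = contradiction refl x≢0
nonzero (Fin.suc y) _ = y , refl

-- An m-cycle on two or more points moves 0: if it fixed 0, then {0} and the cycle through 1
-- would be two different cycles.
mcycle-moves-zero : ∀ {m} (ζ : Fin (suc (suc m)) → Fin (suc (suc m))) → IsMCycle ζ → ζ Fin.zero ≢ Fin.zero
mcycle-moves-zero {m} ζ (ζ-inj , one) ζ0≡0 = ℕ.<-irrefl (sym (ℕ.suc-injective (trans (sym cycles≡) one))) rep-other
  where
  module Z = Orbit ζ ζ-inj
  others = Data.List.tabulate {n = suc m} Fin.suc
  cycles≡ : cycles ζ ≡ suc (length (filter (isRep? ζ) others))
  cycles≡ = cong length (filter-accept (isRep? ζ) {x = Fin.zero} {xs = others} (λ _ → z≤n))
  zero-fixed : ∀ t → iter ζ t Fin.zero ≡ Fin.zero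
  zero-fixed zero = refl
  zero-fixed (suc t) = trans (cong (iter ζ t) ζ0≡0) (zero-fixed t)
  rep₁≢0 : Z.rep (Fin.suc Fin.zero) ≢ Fin.zero
  rep₁≢0 r≡0 with Z.~-sym (subst (Fin.suc Fin.zero Z.~_) r≡0 (Z.~rep (Fin.suc Fin.zero)))
  ... | t , e = contradiction (trans (sym (zero-fixed t)) e) λ ()
  rep-other : 0 < length (filter (isRep? ζ) others)
  rep-other with nonzero _ rep₁≢0
  ... | k , r≡k = filter-some (isRep? ζ) (lose (∈-tabulate⁺ {f = Fin.suc} k) (subst (IsRep ζ) r≡k (Z.rep-IsRep (Fin.suc Fin.zero))))

predecessor-of-zero : ∀ {m} (ζ : Fin (suc m) → Fin (suc m)) → IsInjective ζ → ζ Fin.zero ≢ Fin.zero →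
  ∃ λ a → ζ (Fin.suc a) ≡ Fin.zero
predecessor-of-zero ζ ζ-inj ζ0≢0 = preimage _ (trans (sym (Z.iter-suc t Fin.zero)) (Z.iter-order Fin.zero))
  where
  module Z = Orbit ζ ζ-inj
  t = toℕ (proj₁ (Z.first-return Fin.zero))
  preimage : ∀ x → ζ x ≡ Fin.zero → ∃ λ a → ζ (Fin.suc a) ≡ Fin.zero
  preimage Fin.zero ζ0≡0 = contradiction ζ0≡0 ζ0≢0
  preimage (Fin.suc a) ζa≡0 = a , ζa≡0

predecessor : ∀ {m} → (Fin (suc (suc m)) → Fin (suc (suc m))) → Fin (suc m)
predecessor ζ with any? (λ a → ζ (Fin.suc a) Fin.≟ Fin.zero)
... | yes (a , _) = a
... | no _ = Fin.zero

predecessor-spec : ∀ {m} (ζ : Fin (suc (suc m)) → Fin (suc (suc m))) → (∃ λ a → ζ (Fin.suc a) ≡ Fin.zero) →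
  ζ (Fin.suc (predecessor ζ)) ≡ Fin.zero
predecessor-spec ζ ∃a with any? (λ a → ζ (Fin.suc a) Fin.≟ Fin.zero)
... | yes (a , ζa≡0) = ζa≡0
... | no ∄a = contradiction ∃a ∄a

predecessor-unique : ∀ {m} (ζ : Fin (suc (suc m)) → Fin (suc (suc m))) → IsInjective ζ →
  ∀ {a} → ζ (Fin.suc a) ≡ Fin.zero → predecessor ζ ≡ a
predecessor-unique ζ ζ-inj {a} ζa≡0 = Fin.suc-injective (ζ-inj _ _ (trans (predecessor-spec ζ (a , ζa≡0)) (sym ζa≡0)))

-- Splitting an (M+1)-cycle ζ into (cut ζ, predecessor of 0) and joining back by insertion
-- are inverse bijections between the counted cycles for lift σ and the counted cycles for σ
-- paired with an arbitrary point.
module LiftCount {m} (σ : Permutation′ (suc m)) (j : ℕ) where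
  M N : ℕ
  M = suc m
  N = suc M

  split : Vec (Fin N) N → Vec (Fin M) M × Fin M
  split v = tabulate (cut (lookup v)) , predecessor (lookup v)

  join : Vec (Fin M) M × Fin M → Vec (Fin N) N
  join (w , a) = tabulate (insert (lookup w) a)

  split-counted : ∀ v → Counted (lift₀ σ) j v → Counted σ j (proj₁ (split v))
  split-counted v ((ζ-inj , one) , expo≡j) =
    mcycle-cong (sym ∘ lookup∘tabulate (cut ζ)) (C.cut-inj , trans (sym C.cycles-cut) one) ,
    trans (expo-cong σ (lookup∘tabulate (cut ζ)))
      (trans (cong (λ c → (c ∸ 1) / 2) (sym (cycles-product-cut σ ζ ζ-inj ζ0≡j₀))) expo≡j)
    where
    ζ = lookup v
    ζ0≡j₀ = proj₂ (nonzero _ (mcycle-moves-zero ζ (ζ-inj , one)))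
    module C = Cut ζ ζ-inj ζ0≡j₀

  join-counted : ∀ p → Counted σ j (proj₁ p) → Counted (lift₀ σ) j (join p)
  join-counted (w , a) ((ω-inj , one) , expo≡j) =
    mcycle-cong (sym ∘ lookup∘tabulate ζ) (ζ-inj , trans C.cycles-cut (trans (cycles-cong (cut-insert ω a)) one)) ,
    (begin
      expo (lift₀ σ) (lookup (tabulate ζ))  ≡⟨ expo-cong (lift₀ σ) (lookup∘tabulate ζ) ⟩
      expo (lift₀ σ) ζ                      ≡⟨ cong (λ c → (c ∸ 1) / 2) (cycles-product-cut σ ζ ζ-inj refl) ⟩
      expo σ (cut ζ)                        ≡⟨ expo-cong σ (cut-insert ω a) ⟩
      expo σ ω                              ≡⟨ expo≡j ⟩
      j                                     ∎)
    where
    ω = lookup w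
    ζ = insert ω a
    ζ-inj = insert-inj ω a ω-inj
    module C = Cut ζ ζ-inj refl

  join-split : ∀ v → Counted (lift₀ σ) j v → join (split v) ≡ v
  join-split v ((ζ-inj , one) , _) = trans (tabulate-cong λ x →
      trans (insert-cong (lookup∘tabulate (cut ζ)) (predecessor ζ) x)
        (insert-cut ζ ζ-inj (predecessor-spec ζ (predecessor-of-zero ζ ζ-inj ζ0≢0)) ζ0≡j₀ x))
    (tabulate∘lookup v)
    where
    ζ = lookup v
    ζ0≢0 = mcycle-moves-zero ζ (ζ-inj , one)
    ζ0≡j₀ = proj₂ (nonzero _ ζ0≢0)

  split-join : ∀ p → Counted σ j (proj₁ p) → split (join p) ≡ p
  split-join (w , a) ((ω-inj , _) , _) = cong₂ _,_
    (trans (tabulate-cong λ x → trans (cut-cong (lookup∘tabulate ζ) x) (cut-insert ω a x)) (tabulate∘lookup w))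
    (predecessor-unique (lookup (tabulate ζ)) (injective-cong (sym ∘ lookup∘tabulate ζ) (insert-inj ω a ω-inj))
      (trans (lookup∘tabulate ζ (Fin.suc a)) (insert-at ω a)))
    where
    ω = lookup w
    ζ = insert ω a

F-lift : ∀ {M} (σ : Permutation′ M) → 1 ≤ M → ∀ j → F (lift₀ σ) j ≡ M * F σ j
F-lift {suc m} σ _ j = begin
  F (lift₀ σ) j                                                      ≡⟨ F-as-count (lift₀ σ) j ⟩
  length (filter (counted? (lift₀ σ) j) (allVecs N N))               ≡⟨ count-bijection (counted? (lift₀ σ) j) (counted? σ j ∘ proj₁)
                                                                          (allVecs N N) pairs (allVecs-unique N N)
                                                                          (Unique.cartesianProduct⁺ (allVecs-unique M M) (Unique.allFin⁺ M))
                                                                          (λ v _ → allVecs-complete N N v)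
                                                                          (λ (w , a) _ → ∈-cartesianProduct⁺ (allVecs-complete M M w) (∈-allFin a))
                                                                          split join split-counted join-counted join-split split-join ⟩
  length (filter (counted? σ j ∘ proj₁) pairs)                       ≡⟨ count-first (counted? σ j) (allVecs M M) (allFin M) ⟩
  length (filter (counted? σ j) (allVecs M M)) * length (allFin M)   ≡⟨ cong₂ _*_ (F-as-count σ j) (sym (length-tabulate (λ a → a))) ⟨
  F σ j * M                                                          ≡⟨ ℕ.*-comm (F σ j) M ⟩
  M * F σ j                                                          ∎
  where
  open LiftCount σ j
  pairs = cartesianProduct (allVecs M M) (allFin M)

filter-suc : ∀ {m} {P : Pred (Fin (suc m)) 0ℓ} {Q : Pred (Fin m) 0ℓ} (P? : Decidable P) (Q? : Decidable Q) →
  (∀ i → P (Fin.suc i) ⇔ Q i) → filter P? (Data.List.tabulate Fin.suc) ≡ map Fin.suc (filter Q? (allFin m))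
filter-suc {m} P? Q? P⇔Q = begin
  filter P? (Data.List.tabulate Fin.suc)   ≡⟨ cong (filter P?) (map-tabulate (λ i → i) Fin.suc) ⟨
  filter P? (map Fin.suc (allFin m))       ≡⟨ filter-map P? Fin.suc (allFin m) ⟩
  map Fin.suc (filter (P? ∘ Fin.suc) (allFin m))
    ≡⟨ cong (map Fin.suc) (filter-≐ (P? ∘ Fin.suc) Q? (Equivalence.to (P⇔Q _) , Equivalence.from (P⇔Q _)) (allFin m)) ⟩
  map Fin.suc (filter Q? (allFin m))       ∎

module LiftCycles {m} (σ : Permutation′ m) where
  private
    s : Fin m → Fin m
    s = σ ⟨$⟩ʳ_
    l : Fin (suc m) → Fin (suc m)
    l = lift₀ σ ⟨$⟩ʳ_
    module S = Orbit s (permutation-inj σ)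
    module L = Orbit l (permutation-inj (lift₀ σ))

  iter-lift-suc : ∀ t i → iter l t (Fin.suc i) ≡ Fin.suc (iter s t i)
  iter-lift-suc zero i = refl
  iter-lift-suc (suc t) i = iter-lift-suc t (s i)

  iter-lift-zero : ∀ t → iter l t Fin.zero ≡ Fin.zero
  iter-lift-zero zero = refl
  iter-lift-zero (suc t) = iter-lift-zero t

  ~-lift : ∀ {i y} → i S.~ y → Fin.suc i L.~ Fin.suc y
  ~-lift {i} (t , e) = t , trans (iter-lift-suc t i) (cong Fin.suc e)

  IsRep-lift : ∀ i → IsRep l (Fin.suc i) ⇔ IsRep s i
  IsRep-lift i = mk⇔
    (λ isr → S.least⇒IsRep λ y i~y → ≤-pred (L.IsRep⇒least isr (Fin.suc y) (~-lift i~y)))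
    (λ isr → L.least⇒IsRep λ { y (t , refl) →
      subst (Fin.suc i Fin.≤_) (sym (iter-lift-suc t i)) (s≤s (S.IsRep⇒least isr _ (t , refl))) })

  InOrbit-lift : ∀ i y → InOrbit l (Fin.suc i) (Fin.suc y) ⇔ InOrbit s i y
  InOrbit-lift i y = mk⇔
    (λ o → let (t , e) = L.InOrbit⇒~ o in S.~⇒InOrbit (t , Fin.suc-injective (trans (sym (iter-lift-suc t i)) e)))
    (λ o → L.~⇒InOrbit (~-lift (S.InOrbit⇒~ o)))

  zero-alone : ∀ i → ¬ InOrbit l (Fin.suc i) Fin.zero × ¬ InOrbit l Fin.zero (Fin.suc i)
  zero-alone i = (λ (t , e) → contradiction (trans (sym (iter-lift-suc (toℕ t) i)) e) λ ())
               , (λ (t , e) → contradiction (trans (sym (iter-lift-zero (toℕ t))) e) λ ())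

  cycleLength-lift-suc : ∀ i → cycleLength l (Fin.suc i) ≡ cycleLength s i
  cycleLength-lift-suc i = begin
    length (filter (inOrbit? l (Fin.suc i)) (allFin (suc m)))          ≡⟨ cong length (filter-reject (inOrbit? l (Fin.suc i)) {xs = Data.List.tabulate Fin.suc} (proj₁ (zero-alone i))) ⟩
    length (filter (inOrbit? l (Fin.suc i)) (Data.List.tabulate Fin.suc)) ≡⟨ cong length (filter-suc (inOrbit? l (Fin.suc i)) (inOrbit? s i) (InOrbit-lift i)) ⟩
    length (map Fin.suc (filter (inOrbit? s i) (allFin m)))             ≡⟨ length-map Fin.suc (filter (inOrbit? s i) (allFin m)) ⟩
    cycleLength s i                                                     ∎

  cycleLength-lift-zero : cycleLength l Fin.zero ≡ 1
  cycleLength-lift-zero = cong length (trans (filter-accept (inOrbit? l Fin.zero) {xs = Data.List.tabulate Fin.suc} (Fin.zero , refl))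
    (cong (Fin.zero ∷_) (filter-none (inOrbit? l Fin.zero) (All-tabulate⁺ (proj₂ ∘ zero-alone)))))

  cycleType-lift : cycleType l ≡ 1 ∷ cycleType s
  cycleType-lift = begin
    map (cycleLength l) (filter (isRep? l) (allFin (suc m)))
      ≡⟨ cong (map (cycleLength l)) (filter-accept (isRep? l) {x = Fin.zero} {xs = Data.List.tabulate Fin.suc} (λ _ → z≤n)) ⟩
    cycleLength l Fin.zero ∷ map (cycleLength l) (filter (isRep? l) (Data.List.tabulate Fin.suc))
      ≡⟨ cong₂ _∷_ cycleLength-lift-zero (cong (map (cycleLength l)) (filter-suc (isRep? l) (isRep? s) IsRep-lift)) ⟩
    1 ∷ map (cycleLength l) (map Fin.suc (filter (isRep? s) (allFin m)))
      ≡⟨ cong (1 ∷_) (trans (sym (map-∘ _)) (map-cong cycleLength-lift-suc _)) ⟩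
    1 ∷ cycleType s ∎

P′-suc : ∀ n k → suc n P′ suc k ≡ suc n * (n P′ k)
P′-suc n zero = refl
P′-suc n (suc k) = begin
  (n ∸ k) * (suc n P′ suc k)   ≡⟨ cong ((n ∸ k) *_) (P′-suc n k) ⟩
  (n ∸ k) * (suc n * (n P′ k)) ≡⟨ ℕ.*-assoc (n ∸ k) (suc n) (n P′ k) ⟨
  (n ∸ k) * suc n * (n P′ k)   ≡⟨ cong (_* (n P′ k)) (ℕ.*-comm (n ∸ k) (suc n)) ⟩
  suc n * (n ∸ k) * (n P′ k)   ≡⟨ ℕ.*-assoc (suc n) (n ∸ k) (n P′ k) ⟩
  suc n * (n P′ suc k)         ∎

P≡P′ : ∀ {n k} → k ≤ n → n P k ≡ n P′ k
P≡P′ {n} {k} k≤n with k ℕ.≤ᵇ n | ℕ.≤⇒≤ᵇ k≤n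
... | true | _ = refl

falling-suc : ∀ n k → k < n → n P suc k ≡ n * ((n ∸ 1) P k)
falling-suc (suc n) k (s≤s k≤n) = trans (P≡P′ (s≤s k≤n)) (trans (P′-suc n k) (cong (suc n *_) (sym (P≡P′ k≤n))))

lifts : ∀ k {d} → Permutation′ d → Permutation′ (k + d)
lifts zero σ = σ
lifts (suc k) σ = lift₀ (lifts k σ)

cycleType-lifts : ∀ k {d} (σ : Permutation′ d) → cycleType (lifts k σ ⟨$⟩ʳ_) ↭ cycleType (σ ⟨$⟩ʳ_) ++ replicate k 1
cycleType-lifts zero σ = ↭-reflexive (sym (++-identityʳ _))
cycleType-lifts (suc k) σ = ↭-trans (↭-reflexive (LiftCycles.cycleType-lift (lifts k σ)))
  (↭-trans (↭-prep 1 (cycleType-lifts k σ)) (↭-sym (shift 1 (cycleType (σ ⟨$⟩ʳ_)) (replicate k 1))))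

F-lifts : ∀ k {d} → 1 ≤ d → (σ : Permutation′ d) → ∀ j → F (lifts k σ) j ≡ ((k + d ∸ 1) P k) * F σ j
F-lifts zero {d} _ σ j = sym (trans (cong (_* F σ j) (P≡P′ {d ∸ 1} z≤n)) (ℕ.*-identityˡ (F σ j)))
F-lifts (suc k) {d} 1≤d σ j = begin
  F (lift₀ (lifts k σ)) j                  ≡⟨ F-lift (lifts k σ) (≤-trans 1≤d (ℕ.m≤n+m d k)) j ⟩
  (k + d) * F (lifts k σ) j                ≡⟨ cong ((k + d) *_) (F-lifts k 1≤d σ j) ⟩
  (k + d) * (((k + d ∸ 1) P k) * F σ j)    ≡⟨ ℕ.*-assoc (k + d) ((k + d ∸ 1) P k) (F σ j) ⟨
  ((k + d) * ((k + d ∸ 1) P k)) * F σ j    ≡⟨ cong (_* F σ j) (falling-suc (k + d) k (m<m+n k 1≤d)) ⟨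
  ((k + d) P suc k) * F σ j                ∎

fixed-points : ∀ k d n → k + d ≡ n → 1 ≤ d → (μ : List ℕ) (π : Permutation′ n) → HasType π (μ ++ replicate k 1) →
  (σ : Permutation′ d) → HasType σ μ → ∀ j → F π j ≡ ((n ∸ 1) P k) * F σ j
fixed-points k d .(k + d) refl 1≤d μ π π-type σ σ-type j = begin
  F π j                        ≡⟨ F-type π (lifts k σ) same-type j ⟩
  F (lifts k σ) j              ≡⟨ F-lifts k 1≤d σ j ⟩
  ((k + d ∸ 1) P k) * F σ j    ∎
  where
  same-type : cycleType (π ⟨$⟩ʳ_) ↭ cycleType (lifts k σ ⟨$⟩ʳ_)
  same-type = ↭-trans π-type (↭-sym (↭-trans (cycleType-lifts k σ) (++⁺ʳ (replicate k 1) σ-type)))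

corollary2p2 : (n k : ℕ) → k < n → (μ : List ℕ) → IsPartition (n ∸ k) μ →
    (π : Permutation′ n) → HasType π (μ ++ replicate k 1) →
    (σ : Permutation′ (n ∸ k)) → HasType σ μ →
    (j : ℕ) → F π j ≡ ((n ∸ 1) P k) * F σ j
corollary2p2 n k k<n μ _ π π-type σ σ-type =
  fixed-points k (n ∸ k) n (m+[n∸m]≡n (<⇒≤ k<n)) (ℕ.m<n⇒0<n∸m k<n) μ π π-type σ σ-type
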